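{- Let $N\ge1$, $f:\mathbb{N}^N\to\mathbb{N}$, $p$ a prime, $m\ge1$ an integer and $\boldsymbol{\ell}\in\mathbb{N}^N$. Then $\binom{p^m}{\boldsymbol{\ell}}_f\equiv f(\mathbf{v})\pmod p$ if $\boldsymbol{\ell}=p^m\mathbf{v}$ for some $\mathbf{v}\in\mathbb{N}^N$, and $\binom{p^m}{\boldsymbol{\ell}}_f\equiv0\pmod p$ otherwise.
   Context: $\mathbb{N}=\{0,1,2,\dots\}$. For $k\ge0$ and $\boldsymbol{\ell}\in\mathbb{N}^N$, $\binom{k}{\boldsymbol{\ell}}_f=\sum f(\mathbf{m}_1)\cdots f(\mathbf{m}_k)$ over all ordered $k$-tuples of vectors $\mathbf{m}_j\in\mathbb{N}^N$ with $\mathbf{m}_1+\cdots+\mathbf{m}_k=\boldsymbol{\ell}$. -}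

module Defs where

open import Data.Nat using (ℕ; zero; suc; _+_; _*_; _∸_)
open import Data.Vec using (Vec; []; _∷_; zipWith; replicate)
open import Data.List using (List; []; _∷_; [_]; concatMap; map; upTo)
open import Data.Nat.ListAction using (sum)
open import Data.Bool using (Bool; true; false; _∧_)
open import Data.Nat using (_≡ᵇ_)

boxBelow : ∀ {N} → Vec ℕ N → List (Vec ℕ N)
boxBelow [] = [ [] ]
boxBelow (a ∷ ℓ) = concatMap (λ i → map (i ∷_) (boxBelow ℓ)) (upTo (suc a))

isZeroVec : ∀ {N} → Vec ℕ N → Bool
isZeroVec [] = true
isZeroVec (a ∷ v) = (a ≡ᵇ 0) ∧ isZeroVec v

-- all ordered k-tuples (m₁,…,m_k) of vectors in ℕ^N with m₁+⋯+m_k = ℓ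
-- (each m_j is necessarily ≤ ℓ componentwise, so this list is exhaustive,
--  and each tuple appears exactly once)
tuples : ∀ {N} (k : ℕ) → Vec ℕ N → List (Vec (Vec ℕ N) k)
tuples zero ℓ with isZeroVec ℓ
... | true = [ [] ]
... | false = []
tuples (suc k) ℓ = concatMap (λ m → map (m ∷_) (tuples k (zipWith _∸_ ℓ m))) (boxBelow ℓ)

prodF : ∀ {N k} → (Vec ℕ N → ℕ) → Vec (Vec ℕ N) k → ℕ
prodF f [] = 1
prodF f (m ∷ ms) = f m * prodF f ms

binomF : ∀ {N} → (Vec ℕ N → ℕ) → ℕ → Vec ℕ N → ℕ
binomF f k ℓ = sum (map (prodF f) (tuples k ℓ))

scale : ∀ {N} → ℕ → Vec ℕ N → Vec ℕ N
scale c v = Data.Vec.map (c *_) v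

module Submission where

-- binomF f k ℓ is the coefficient of X^ℓ in F^k, where F = Σₘ f(m) X^m is the generating series of f in
-- N variables. Only residues modulo p matter, so we compute with power series over ℕ modulo p, which has
-- characteristic p. There (x + y)^p = x^p + y^p, because p divides C(p, k) for 0 < k < p, and a^p = a on
-- the coefficients (Fermat), so F^p = F(X₁^p, …, X_N^p); a series in N + 1 variables is a one-variable
-- series over series in N variables, so this is proved one variable at a time. Iterating,
-- F^(p^m) = F(X₁^(p^m), …, X_N^(p^m)), whose coefficient at ℓ is f(v) if ℓ = p^m v and 0 otherwise.

open import Level using (0ℓ)
open import Algebra.Bundles using (CommutativeSemiring)
open import Algebra.Structures using (IsCommutativeSemiring; IsCommutativeMonoid)
open import Algebra.Structures.Biased using (isCommutativeSemiringˡ)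
import Algebra.Properties.Semiring.Mult
import Algebra.Properties.Semiring.Exp
open import Data.Bool using (true; false; if_then_else_)
open import Data.Fin using (zero; suc; toℕ; fromℕ; inject₁)
open import Data.Fin.Properties using (toℕ-fromℕ; toℕ-inject₁; toℕ<n)
open import Data.List as List using (List; []; _∷_; concatMap; map; upTo; applyUpTo; foldr)
open import Data.List.Properties using (map-∘; map-cong; map-++; map-applyUpTo)
open import Data.Nat as ℕ using (ℕ; zero; suc; _∸_; _<_; z<s; s<s; s≤s; z≤n; NonZero; _≤_; _%_; _/_)
import Data.Nat.Properties as ℕ
open import Data.Nat.Combinatorics using (_C_; nCn≡1; nCk+nC[k+1]≡[n+1]C[k+1])
open import Data.Nat.Combinatorics.Specification using (k>n⇒nCk≡0)
open import Data.Nat.Divisibility using (_∣_; divides; >⇒∤)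
open import Data.Nat.DivMod
  using (%-distribˡ-+; %-distribˡ-*; m≡m%n+[m/n]*n; m%n<n; m*n%n≡0; m*n/n≡m; m<n⇒m%n≡m)
open import Data.Nat.GeneralisedArithmetic using (iterate)
open import Data.Nat.ListAction using (sum)
open import Data.Nat.ListAction.Properties using (sum-++)
open import Data.Nat.Primality using (Prime; prime⇒nonZero; prime⇒nonTrivial; euclidsLemma)
open import Data.Product using (∃; _,_)
open import Data.Sum using (_⊎_; inj₁; inj₂)
open import Data.Vec using (Vec; []; _∷_; zipWith)
open import Function using (_∘_; id)
open import Relation.Binary.PropositionalEquality as ≡ using (_≡_)
open import Relation.Binary.Structures using (IsEquivalence)
import Relation.Binary.Construct.On as On
open import Relation.Nullary using (¬_; contradiction)
open import Defs

[k+1]*[n+1]C[k+1]≡[n+1]*nCk : ∀ n k → suc k ℕ.* (suc n C suc k) ≡ suc n ℕ.* (n C k)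
[k+1]*[n+1]C[k+1]≡[n+1]*nCk zero zero    = ≡.refl
[k+1]*[n+1]C[k+1]≡[n+1]*nCk zero (suc k) =
  ≡.trans (≡.cong (suc (suc k) ℕ.*_) (k>n⇒nCk≡0 {1} {suc (suc k)} (s≤s (s≤s z≤n))))
          (ℕ.*-zeroʳ (suc (suc k)))
[k+1]*[n+1]C[k+1]≡[n+1]*nCk (suc n) k = begin
  suc k ℕ.* (suc (suc n) C suc k)
    ≡⟨ ≡.cong (suc k ℕ.*_) (nCk+nC[k+1]≡[n+1]C[k+1] (suc n) k) ⟨
  suc k ℕ.* (A ℕ.+ B)
    ≡⟨ ℕ.*-distribˡ-+ (suc k) A B ⟩
  (A ℕ.+ k ℕ.* A) ℕ.+ suc k ℕ.* B
    ≡⟨ ≡.cong₂ (λ x y → (A ℕ.+ x) ℕ.+ y) (k*A k) ([k+1]*[n+1]C[k+1]≡[n+1]*nCk n k) ⟩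
  (A ℕ.+ suc n ℕ.* nC[k-1] k) ℕ.+ suc n ℕ.* (n C k)
    ≡⟨ ℕ.+-assoc A _ _ ⟩
  A ℕ.+ (suc n ℕ.* nC[k-1] k ℕ.+ suc n ℕ.* (n C k))
    ≡⟨ ≡.cong (A ℕ.+_) (ℕ.*-distribˡ-+ (suc n) (nC[k-1] k) (n C k)) ⟨
  A ℕ.+ suc n ℕ.* (nC[k-1] k ℕ.+ n C k)
    ≡⟨ ≡.cong (λ x → A ℕ.+ suc n ℕ.* x) (pascal k) ⟩
  A ℕ.+ suc n ℕ.* A
    ∎
  where
  open ≡.≡-Reasoning
  A = suc n C k
  B = suc n C suc k
  nC[k-1] : ℕ → ℕ
  nC[k-1] zero    = 0
  nC[k-1] (suc j) = n C j
  k*A : ∀ k → k ℕ.* (suc n C k) ≡ suc n ℕ.* nC[k-1] k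
  k*A zero    = ≡.sym (ℕ.*-zeroʳ (suc n))
  k*A (suc j) = [k+1]*[n+1]C[k+1]≡[n+1]*nCk n j
  pascal : ∀ k → nC[k-1] k ℕ.+ n C k ≡ suc n C k
  pascal zero    = ≡.refl
  pascal (suc j) = nCk+nC[k+1]≡[n+1]C[k+1] n j

p∣pCk : ∀ {p k} → Prime p → 0 < k → k < p → p ∣ p C k
p∣pCk {suc n} {suc j} p-prime _ k<p
  with euclidsLemma (suc j) (suc n C suc j) p-prime
         (divides (n C j) (≡.trans ([k+1]*[n+1]C[k+1]≡[n+1]*nCk n j) (ℕ.*-comm (suc n) (n C j))))
... | inj₁ p∣k   = contradiction p∣k (>⇒∤ k<p)
... | inj₂ p∣pCk = p∣pCk

module _ {c ℓ} (R : CommutativeSemiring c ℓ) where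

  open CommutativeSemiring R hiding (zero)
  open import Algebra.Properties.Semiring.Mult semiring using (_×_; ×-congˡ; ×-assocˡ)
  open import Algebra.Properties.Semiring.Exp semiring using (_^_)
  open import Algebra.Properties.Semiring.Sum semiring
    using (sum-init-last; sum-cong-≋; sum-replicate-zero) renaming (sum to ∑)
  open import Algebra.Properties.CommutativeSemiring.Binomial R using (binomialTerm; theorem)
  open import Relation.Binary.Reasoning.Setoid setoid

  frobenius-+ : ∀ {p} → Prime p → (∀ x → p × x ≈ 0#) → ∀ x y → (x + y) ^ p ≈ x ^ p + y ^ p
  frobenius-+ {zero} p-prime with () ← ℕ.nonTrivial⇒n>1 0 {{prime⇒nonTrivial p-prime}}
  frobenius-+ {p@(suc n)} p-prime char x y = begin
    (x + y) ^ p                                                     ≈⟨ theorem p x y ⟩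
    term zero + ∑ (term ∘ suc)                                      ≈⟨ +-congˡ (sum-init-last (term ∘ suc)) ⟩
    term zero + (∑ (term ∘ suc ∘ inject₁) + term (suc (fromℕ n)))  ≈⟨ +-cong first (+-cong middle last) ⟩
    y ^ p + (0# + x ^ p)                                            ≈⟨ +-congˡ (+-identityˡ (x ^ p)) ⟩
    y ^ p + x ^ p                                                   ≈⟨ +-comm (y ^ p) (x ^ p) ⟩
    x ^ p + y ^ p                                                   ∎
    where
    term = binomialTerm x y p

    first : term zero ≈ y ^ p
    first = trans (+-identityʳ _) (*-identityˡ _)

    last : term (suc (fromℕ n)) ≈ x ^ p
    last rewrite toℕ-fromℕ n | nCn≡1 p | ℕ.n∸n≡0 p = trans (+-identityʳ _) (*-identityʳ _)

    vanishes : ∀ k → 0 < k → k < p → ∀ z → (p C k) × z ≈ 0#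
    vanishes k 0<k k<p z with p∣pCk p-prime 0<k k<p
    ... | divides d pCk≡d*p = begin
      (p C k) × z    ≈⟨ ×-congˡ (≡.trans pCk≡d*p (ℕ.*-comm d p)) ⟩
      (p ℕ.* d) × z  ≈⟨ ×-assocˡ z p d ⟨
      p × (d × z)    ≈⟨ char (d × z) ⟩
      0#             ∎

    middle : ∑ (term ∘ suc ∘ inject₁) ≈ 0#
    middle = trans (sum-cong-≋ λ i → vanishes _ z<s (s<s (inject₁<n i)) _) (sum-replicate-zero n)
      where
      inject₁<n : ∀ i → toℕ (inject₁ i) < n
      inject₁<n i = ≡.subst (_< n) (≡.sym (toℕ-inject₁ i)) (toℕ<n i)

module ℕModulo (p : ℕ) .{{_ : NonZero p}} where

  infix 4 _≡ₚ_
  _≡ₚ_ : ℕ → ℕ → Set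
  a ≡ₚ b = a % p ≡ b % p

  ≡⇒≡ₚ : ∀ {a b} → a ≡ b → a ≡ₚ b
  ≡⇒≡ₚ = ≡.cong (_% p)

  +-cong : ∀ {a a′ b b′} → a ≡ₚ a′ → b ≡ₚ b′ → a ℕ.+ b ≡ₚ a′ ℕ.+ b′
  +-cong {a} {a′} {b} {b′} a≡a′ b≡b′ = begin
    (a ℕ.+ b) % p              ≡⟨ %-distribˡ-+ a b p ⟩
    (a % p ℕ.+ b % p) % p      ≡⟨ ≡.cong₂ (λ x y → (x ℕ.+ y) % p) a≡a′ b≡b′ ⟩
    (a′ % p ℕ.+ b′ % p) % p    ≡⟨ %-distribˡ-+ a′ b′ p ⟨
    (a′ ℕ.+ b′) % p            ∎
    where open ≡.≡-Reasoning

  *-cong : ∀ {a a′ b b′} → a ≡ₚ a′ → b ≡ₚ b′ → a ℕ.* b ≡ₚ a′ ℕ.* b′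
  *-cong {a} {a′} {b} {b′} a≡a′ b≡b′ = begin
    (a ℕ.* b) % p              ≡⟨ %-distribˡ-* a b p ⟩
    (a % p ℕ.* (b % p)) % p    ≡⟨ ≡.cong₂ (λ x y → (x ℕ.* y) % p) a≡a′ b≡b′ ⟩
    (a′ % p ℕ.* (b′ % p)) % p  ≡⟨ %-distribˡ-* a′ b′ p ⟨
    (a′ ℕ.* b′) % p            ∎
    where open ≡.≡-Reasoning

  isCommutativeSemiring : IsCommutativeSemiring _≡ₚ_ ℕ._+_ ℕ._*_ 0 1
  isCommutativeSemiring = isCommutativeSemiringˡ record
    { +-isCommutativeMonoid = isCommutativeMonoid +-cong ℕ.+-assoc ℕ.+-identityˡ ℕ.+-identityʳ ℕ.+-comm
    ; *-isCommutativeMonoid = isCommutativeMonoid *-cong ℕ.*-assoc ℕ.*-identityˡ ℕ.*-identityʳ ℕ.*-comm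
    ; distribʳ              = λ a b c → ≡⇒≡ₚ (ℕ.*-distribʳ-+ a b c)
    ; zeroˡ                 = λ a → ≡.refl
    }
    where
    isCommutativeMonoid : ∀ {_∙_ ε} →
                          (∀ {a a′ b b′} → a ≡ₚ a′ → b ≡ₚ b′ → a ∙ b ≡ₚ a′ ∙ b′) →
                          (∀ a b c → (a ∙ b) ∙ c ≡ a ∙ (b ∙ c)) →
                          (∀ a → ε ∙ a ≡ a) → (∀ a → a ∙ ε ≡ a) → (∀ a b → a ∙ b ≡ b ∙ a) →
                          IsCommutativeMonoid _≡ₚ_ _∙_ ε
    isCommutativeMonoid ∙-cong assoc identityˡ identityʳ comm = record
      { isMonoid = record
        { isSemigroup = record
          { isMagma  = record { isEquivalence = On.isEquivalence (_% p) ≡.isEquivalence ; ∙-cong = ∙-cong }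
          ; assoc    = λ a b c → ≡⇒≡ₚ (assoc a b c)
          }
        ; identity = (λ a → ≡⇒≡ₚ (identityˡ a)) , (λ a → ≡⇒≡ₚ (identityʳ a))
        }
      ; comm = λ a b → ≡⇒≡ₚ (comm a b)
      }

  commutativeSemiring : CommutativeSemiring 0ℓ 0ℓ
  commutativeSemiring = record { isCommutativeSemiring = isCommutativeSemiring }

  open CommutativeSemiring commutativeSemiring using (semiring; setoid)
  open import Algebra.Properties.Semiring.Mult semiring using (_×_)
  open import Algebra.Properties.Semiring.Exp semiring using (_^_)

  ×≡* : ∀ n a → n × a ≡ n ℕ.* a
  ×≡* zero    a = ≡.refl
  ×≡* (suc n) a = ≡.cong (a ℕ.+_) (×≡* n a)

  characteristic : ∀ a → p × a ≡ₚ 0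
  characteristic a = begin
    (p × a) % p    ≡⟨ ≡⇒≡ₚ (≡.trans (×≡* p a) (ℕ.*-comm p a)) ⟩
    (a ℕ.* p) % p  ≡⟨ m*n%n≡0 a p ⟩
    0              ≡⟨ m<n⇒m%n≡m (ℕ.>-nonZero⁻¹ p) ⟨
    0 % p          ∎
    where open ≡.≡-Reasoning

  1^n≡1 : ∀ n → 1 ^ n ≡ 1
  1^n≡1 zero    = ≡.refl
  1^n≡1 (suc n) = ≡.trans (ℕ.+-identityʳ (1 ^ n)) (1^n≡1 n)

  fermat : Prime p → ∀ a → a ^ p ≡ₚ a
  fermat p-prime zero    = ≡⇒≡ₚ (0^n≡0 p)
    where
    0^n≡0 : ∀ n → .{{NonZero n}} → 0 ^ n ≡ 0
    0^n≡0 (suc n) = ≡.refl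
  fermat p-prime (suc a) = begin
    (1 ℕ.+ a) ^ p    ≈⟨ frobenius-+ commutativeSemiring p-prime characteristic 1 a ⟩
    1 ^ p ℕ.+ a ^ p  ≈⟨ +-cong (≡⇒≡ₚ (1^n≡1 p)) (fermat p-prime a) ⟩
    1 ℕ.+ a          ∎
    where open import Relation.Binary.Reasoning.Setoid setoid

  sum-map-cong : ∀ {A : Set} {g h : A → ℕ} xs → (∀ x → g x ≡ₚ h x) →
                 sum (map g xs) ≡ₚ sum (map h xs)
  sum-map-cong             []       g≡h = ≡.refl
  sum-map-cong {g = g} {h} (x ∷ xs) g≡h = +-cong {g x} {h x} (g≡h x) (sum-map-cong xs g≡h)

module PowerSeries {c ℓ} (R : CommutativeSemiring c ℓ) where

  open CommutativeSemiring R hiding (isCommutativeSemiring)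
  open import Relation.Binary.Reasoning.Setoid setoid

  Series : Set c
  Series = ℕ → Carrier

  infix  4 _≈ₛ_
  infixl 6 _+ₛ_
  infixl 7 _*ₛ_

  _≈ₛ_ : Series → Series → Set ℓ
  F ≈ₛ G = ∀ n → F n ≈ G n

  _+ₛ_ : Series → Series → Series
  (F +ₛ G) n = F n + G n

  _*ₛ_ : Series → Series → Series
  (F *ₛ G) zero    = F 0 * G 0
  (F *ₛ G) (suc n) = F 0 * G (suc n) + ((F ∘ suc) *ₛ G) n

  constant : Carrier → Series
  constant a zero    = a
  constant a (suc _) = 0#

  0ₛ 1ₛ : Series
  0ₛ _ = 0#
  1ₛ   = constant 1#

  shift : Series → Series
  shift F zero    = 0#
  shift F (suc n) = F n

  *ₛ-cong : ∀ {F F′ G G′} → F ≈ₛ F′ → G ≈ₛ G′ → F *ₛ G ≈ₛ F′ *ₛ G′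
  *ₛ-cong F≈F′ G≈G′ zero    = *-cong (F≈F′ 0) (G≈G′ 0)
  *ₛ-cong F≈F′ G≈G′ (suc n) =
    +-cong (*-cong (F≈F′ 0) (G≈G′ (suc n))) (*ₛ-cong (F≈F′ ∘ suc) G≈G′ n)

  *ₛ-zeroˡ : ∀ G → 0ₛ *ₛ G ≈ₛ 0ₛ
  *ₛ-zeroˡ G zero    = zeroˡ (G 0)
  *ₛ-zeroˡ G (suc n) = trans (+-cong (zeroˡ _) (*ₛ-zeroˡ G n)) (+-identityˡ 0#)

  *ₛ-identityˡ : ∀ G → 1ₛ *ₛ G ≈ₛ G
  *ₛ-identityˡ G zero    = *-identityˡ (G 0)
  *ₛ-identityˡ G (suc n) = trans (+-cong (*-identityˡ _) (*ₛ-zeroˡ G n)) (+-identityʳ _)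

  *ₛ-distribʳ : ∀ H F G → (F +ₛ G) *ₛ H ≈ₛ F *ₛ H +ₛ G *ₛ H
  *ₛ-distribʳ H F G zero    = distribʳ (H 0) (F 0) (G 0)
  *ₛ-distribʳ H F G (suc n) =
    trans (+-cong (distribʳ _ _ _) (*ₛ-distribʳ H (F ∘ suc) (G ∘ suc) n)) (interchange _ _ _ _)
    where open import Algebra.Properties.CommutativeSemigroup +-commutativeSemigroup using (interchange)

  *ₛ-unsnoc : ∀ F G n → (F *ₛ G) (suc n) ≈ (F *ₛ (G ∘ suc)) n + F (suc n) * G 0
  *ₛ-unsnoc F G zero    = refl
  *ₛ-unsnoc F G (suc n) = trans (+-congˡ (*ₛ-unsnoc (F ∘ suc) G n)) (sym (+-assoc _ _ _))

  *ₛ-comm : ∀ F G → F *ₛ G ≈ₛ G *ₛ F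
  *ₛ-comm F G zero    = *-comm (F 0) (G 0)
  *ₛ-comm F G (suc n) = begin
    F 0 * G (suc n) + ((F ∘ suc) *ₛ G) n  ≈⟨ +-cong (*-comm _ _) (*ₛ-comm (F ∘ suc) G n) ⟩
    G (suc n) * F 0 + (G *ₛ (F ∘ suc)) n  ≈⟨ +-comm _ _ ⟩
    (G *ₛ (F ∘ suc)) n + G (suc n) * F 0  ≈⟨ *ₛ-unsnoc G F n ⟨
    (G *ₛ F) (suc n)                      ∎

  *ₛ-assoc-scalar : ∀ a F G → (λ n → a * F n) *ₛ G ≈ₛ (λ n → a * (F *ₛ G) n)
  *ₛ-assoc-scalar a F G zero    = *-assoc _ _ _
  *ₛ-assoc-scalar a F G (suc n) =
    trans (+-cong (*-assoc _ _ _) (*ₛ-assoc-scalar a (F ∘ suc) G n)) (sym (distribˡ _ _ _))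

  *ₛ-assoc : ∀ F G H → (F *ₛ G) *ₛ H ≈ₛ F *ₛ (G *ₛ H)
  *ₛ-assoc F G H zero    = *-assoc _ _ _
  *ₛ-assoc F G H (suc n) = begin
    (F 0 * G 0) * H (suc n) + ((F0G′ +ₛ (F ∘ suc) *ₛ G) *ₛ H) n
      ≈⟨ +-congˡ (*ₛ-distribʳ H F0G′ ((F ∘ suc) *ₛ G) n) ⟩
    (F 0 * G 0) * H (suc n) + ((F0G′ *ₛ H) n + (((F ∘ suc) *ₛ G) *ₛ H) n)
      ≈⟨ +-congˡ (+-cong (*ₛ-assoc-scalar (F 0) (G ∘ suc) H n) (*ₛ-assoc (F ∘ suc) G H n)) ⟩
    (F 0 * G 0) * H (suc n) + (F 0 * ((G ∘ suc) *ₛ H) n + ((F ∘ suc) *ₛ (G *ₛ H)) n)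
      ≈⟨ +-assoc _ _ _ ⟨
    ((F 0 * G 0) * H (suc n) + F 0 * ((G ∘ suc) *ₛ H) n) + ((F ∘ suc) *ₛ (G *ₛ H)) n
      ≈⟨ +-congʳ (trans (+-congʳ (*-assoc _ _ _)) (sym (distribˡ _ _ _))) ⟩
    F 0 * (G 0 * H (suc n) + ((G ∘ suc) *ₛ H) n) + ((F ∘ suc) *ₛ (G *ₛ H)) n
      ∎
    where F0G′ = λ k → F 0 * G (suc k)

  isCommutativeSemiring : IsCommutativeSemiring _≈ₛ_ _+ₛ_ _*ₛ_ 0ₛ 1ₛ
  isCommutativeSemiring = isCommutativeSemiringˡ record
    { +-isCommutativeMonoid = record
      { isMonoid = record
        { isSemigroup = record
          { isMagma = record
            { isEquivalence = ≈ₛ-isEquivalence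
            ; ∙-cong        = λ F≈F′ G≈G′ n → +-cong (F≈F′ n) (G≈G′ n)
            }
          ; assoc   = λ F G H n → +-assoc (F n) (G n) (H n)
          }
        ; identity = (λ F n → +-identityˡ (F n)) , (λ F n → +-identityʳ (F n))
        }
      ; comm = λ F G n → +-comm (F n) (G n)
      }
    ; *-isCommutativeMonoid = record
      { isMonoid = record
        { isSemigroup = record
          { isMagma = record { isEquivalence = ≈ₛ-isEquivalence ; ∙-cong = *ₛ-cong }
          ; assoc   = *ₛ-assoc
          }
        ; identity = *ₛ-identityˡ , λ F n → trans (*ₛ-comm F 1ₛ n) (*ₛ-identityˡ F n)
        }
      ; comm = *ₛ-comm
      }
    ; distribʳ = *ₛ-distribʳ
    ; zeroˡ    = *ₛ-zeroˡ
    }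
    where
    ≈ₛ-isEquivalence : IsEquivalence _≈ₛ_
    ≈ₛ-isEquivalence = record
      { refl  = λ n → refl
      ; sym   = λ F≈G n → sym (F≈G n)
      ; trans = λ F≈G G≈H n → trans (F≈G n) (G≈H n)
      }

  commutativeSemiring : CommutativeSemiring c ℓ
  commutativeSemiring = record { isCommutativeSemiring = isCommutativeSemiring }

  open CommutativeSemiring commutativeSemiring using () renaming (semiring to semiringₛ)
  open import Algebra.Properties.Semiring.Mult semiring using (_×_)
  open import Algebra.Properties.Semiring.Exp semiring using (_^_)
  open import Algebra.Properties.Semiring.Mult semiringₛ using () renaming (_×_ to _×ₛ_)
  open import Algebra.Properties.Semiring.Exp semiringₛ using () renaming (_^_ to _^ₛ_; ^-congˡ to ^ₛ-congˡ)

  *ₛ-coeff : ∀ F G n → (F *ₛ G) n ≈ foldr _+_ 0# (applyUpTo (λ i → F i * G (n ∸ i)) (suc n))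
  *ₛ-coeff F G zero    = sym (+-identityʳ _)
  *ₛ-coeff F G (suc n) = +-congˡ (*ₛ-coeff (F ∘ suc) G n)

  ×ₛ-coeff : ∀ m F n → (m ×ₛ F) n ≈ m × F n
  ×ₛ-coeff zero    F n = refl
  ×ₛ-coeff (suc m) F n = +-congˡ (×ₛ-coeff m F n)

  characteristic : ∀ p → (∀ a → p × a ≈ 0#) → ∀ F → p ×ₛ F ≈ₛ 0ₛ
  characteristic p char F n = trans (×ₛ-coeff p F n) (char (F n))

  constant-^ : ∀ a k → constant a ^ₛ k ≈ₛ constant (a ^ k)
  constant-^ a zero    = λ n → refl
  constant-^ a (suc k) = λ n → trans (*ₛ-cong (λ _ → refl) (constant-^ a k) n) (constant-* n)
    where
    constant-* : constant a *ₛ constant (a ^ k) ≈ₛ constant (a * a ^ k)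
    constant-* zero    = refl
    constant-* (suc n) = trans (+-cong (zeroʳ a) (*ₛ-zeroˡ (constant (a ^ k)) n)) (+-identityˡ 0#)

  shiftⁿ : ℕ → Series → Series
  shiftⁿ zero    F = F
  shiftⁿ (suc k) F = shift (shiftⁿ k F)

  shift-cong : ∀ {F G} → F ≈ₛ G → shift F ≈ₛ shift G
  shift-cong F≈G zero    = refl
  shift-cong F≈G (suc n) = F≈G n

  shiftⁿ-cong : ∀ k {F G} → F ≈ₛ G → shiftⁿ k F ≈ₛ shiftⁿ k G
  shiftⁿ-cong zero    F≈G = F≈G
  shiftⁿ-cong (suc k) F≈G = shift-cong (shiftⁿ-cong k F≈G)

  shift-*ₛ : ∀ F G → shift F *ₛ G ≈ₛ shift (F *ₛ G)
  shift-*ₛ F G zero    = zeroˡ (G 0)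
  shift-*ₛ F G (suc n) = trans (+-congʳ (zeroˡ _)) (+-identityˡ _)

  shiftⁿ-*ₛ : ∀ k F G → shiftⁿ k F *ₛ G ≈ₛ shiftⁿ k (F *ₛ G)
  shiftⁿ-*ₛ zero    F G = λ n → refl
  shiftⁿ-*ₛ (suc k) F G = λ n → trans (shift-*ₛ (shiftⁿ k F) G n) (shift-cong (shiftⁿ-*ₛ k F G) n)

  shift-^ : ∀ F k → shift F ^ₛ k ≈ₛ shiftⁿ k (F ^ₛ k)
  shift-^ F zero    = λ n → refl
  shift-^ F (suc k) = λ n → begin
    (shift F *ₛ shift F ^ₛ k) n       ≈⟨ *ₛ-cong (λ _ → refl) (shift-^ F k) n ⟩
    (shift F *ₛ shiftⁿ k (F ^ₛ k)) n  ≈⟨ shift-*ₛ F _ n ⟩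
    shift (F *ₛ shiftⁿ k (F ^ₛ k)) n  ≈⟨ shift-cong F*shiftⁿ n ⟩
    shift (shiftⁿ k (F *ₛ F ^ₛ k)) n  ∎
    where
    F*shiftⁿ : F *ₛ shiftⁿ k (F ^ₛ k) ≈ₛ shiftⁿ k (F *ₛ F ^ₛ k)
    F*shiftⁿ n = trans (*ₛ-comm F _ n) (trans (shiftⁿ-*ₛ k _ F n) (shiftⁿ-cong k (*ₛ-comm _ F) n))

  shiftⁿ-coeff-< : ∀ k F {j} → j < k → shiftⁿ k F j ≡ 0#
  shiftⁿ-coeff-< (suc k) F {zero}  _         = ≡.refl
  shiftⁿ-coeff-< (suc k) F {suc j} (s<s j<k) = shiftⁿ-coeff-< k F j<k

  shiftⁿ-coeff-+ : ∀ k F j → shiftⁿ k F (k ℕ.+ j) ≡ F j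
  shiftⁿ-coeff-+ zero    F j = ≡.refl
  shiftⁿ-coeff-+ (suc k) F j = shiftⁿ-coeff-+ k F j

  onMultiple : ℕ → Carrier → Carrier
  onMultiple zero    a = a
  onMultiple (suc _) a = 0#

  -- spread p φ (Σ aₙ tⁿ) = Σ φ(aₙ) t^(pn)
  spread : (p : ℕ) .{{_ : NonZero p}} → (Carrier → Carrier) → Series → Series
  spread p φ F n = onMultiple (n % p) (φ (F (n / p)))

  module Frobenius {p} (p-prime : Prime p) (char : ∀ a → p × a ≈ 0#)
                   (φ : Carrier → Carrier) (^p≈φ : ∀ a → a ^ p ≈ φ a) where

    private instance
      p-nonZero : NonZero p
      p-nonZero = prime⇒nonZero p-prime

    ^p-expand : ∀ F n → (F ^ₛ p) n ≈ constant (F 0 ^ p) n + shiftⁿ p ((F ∘ suc) ^ₛ p) n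
    ^p-expand F n = begin
      (F ^ₛ p) n
        ≈⟨ ^ₛ-congˡ p split n ⟩
      ((constant (F 0) +ₛ shift (F ∘ suc)) ^ₛ p) n
        ≈⟨ frobenius-+ commutativeSemiring p-prime (characteristic p char) _ _ n ⟩
      (constant (F 0) ^ₛ p) n + (shift (F ∘ suc) ^ₛ p) n
        ≈⟨ +-cong (constant-^ (F 0) p n) (shift-^ (F ∘ suc) p n) ⟩
      constant (F 0 ^ p) n + shiftⁿ p ((F ∘ suc) ^ₛ p) n
        ∎
      where
      split : F ≈ₛ constant (F 0) +ₛ shift (F ∘ suc)
      split zero    = sym (+-identityʳ _)
      split (suc n) = sym (+-identityˡ _)

    ^p-coeff : ∀ F q r → r < p → (F ^ₛ p) (q ℕ.* p ℕ.+ r) ≈ onMultiple r (φ (F q))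
    ^p-coeff F zero r r<p = begin
      (F ^ₛ p) r
        ≈⟨ ^p-expand F r ⟩
      constant (F 0 ^ p) r + shiftⁿ p ((F ∘ suc) ^ₛ p) r
        ≡⟨ ≡.cong (constant (F 0 ^ p) r +_) (shiftⁿ-coeff-< p _ r<p) ⟩
      constant (F 0 ^ p) r + 0#
        ≈⟨ +-identityʳ _ ⟩
      constant (F 0 ^ p) r
        ≈⟨ lowest r ⟩
      onMultiple r (φ (F 0))
        ∎
      where
      lowest : ∀ r → constant (F 0 ^ p) r ≈ onMultiple r (φ (F 0))
      lowest zero    = ^p≈φ (F 0)
      lowest (suc r) = refl
    ^p-coeff F (suc q) r r<p = begin
      (F ^ₛ p) ((p ℕ.+ q ℕ.* p) ℕ.+ r)
        ≡⟨ ≡.cong (F ^ₛ p) (ℕ.+-assoc p (q ℕ.* p) r) ⟩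
      (F ^ₛ p) (p ℕ.+ j)
        ≈⟨ ^p-expand F (p ℕ.+ j) ⟩
      constant (F 0 ^ p) (p ℕ.+ j) + shiftⁿ p ((F ∘ suc) ^ₛ p) (p ℕ.+ j)
        ≡⟨ ≡.cong₂ _+_ (constant-+ p j) (shiftⁿ-coeff-+ p _ j) ⟩
      0# + ((F ∘ suc) ^ₛ p) j
        ≈⟨ +-identityˡ _ ⟩
      ((F ∘ suc) ^ₛ p) j
        ≈⟨ ^p-coeff (F ∘ suc) q r r<p ⟩
      onMultiple r (φ (F (suc q)))
        ∎
      where
      j = q ℕ.* p ℕ.+ r
      constant-+ : ∀ m n → .{{NonZero m}} → constant (F 0 ^ p) (m ℕ.+ n) ≡ 0#
      constant-+ (suc m) n = ≡.refl

    ^p≈spread : ∀ F → F ^ₛ p ≈ₛ spread p φ F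
    ^p≈spread F n = begin
      (F ^ₛ p) n
        ≡⟨ ≡.cong (F ^ₛ p) (≡.trans (m≡m%n+[m/n]*n n p) (ℕ.+-comm (n % p) _)) ⟩
      (F ^ₛ p) (n / p ℕ.* p ℕ.+ n % p)
        ≈⟨ ^p-coeff F (n / p) (n % p) (m%n<n n p) ⟩
      spread p φ F n
        ∎

sum-map-concatMap : ∀ {A B : Set} (h : A → List B) (g : B → ℕ) xs →
                    sum (map g (concatMap h xs)) ≡ sum (map (λ x → sum (map g (h x))) xs)
sum-map-concatMap h g []       = ≡.refl
sum-map-concatMap h g (x ∷ xs) = begin
  sum (map g (h x List.++ concatMap h xs))             ≡⟨ ≡.cong sum (map-++ g (h x) _) ⟩
  sum (map g (h x) List.++ map g (concatMap h xs))     ≡⟨ sum-++ (map g (h x)) _ ⟩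
  sum (map g (h x)) ℕ.+ sum (map g (concatMap h xs))   ≡⟨ ≡.cong (_ ℕ.+_) (sum-map-concatMap h g xs) ⟩
  sum (map g (h x)) ℕ.+ sum (map (λ x → sum (map g (h x))) xs) ∎
  where open ≡.≡-Reasoning

sum-map-*ˡ : ∀ {A : Set} c (g : A → ℕ) xs → sum (map (λ x → c ℕ.* g x) xs) ≡ c ℕ.* sum (map g xs)
sum-map-*ˡ c g []       = ≡.sym (ℕ.*-zeroʳ c)
sum-map-*ˡ c g (x ∷ xs) =
  ≡.trans (≡.cong (c ℕ.* g x ℕ.+_) (sum-map-*ˡ c g xs)) (≡.sym (ℕ.*-distribˡ-+ c (g x) _))

convolution : ∀ {N} → (Vec ℕ N → ℕ) → (Vec ℕ N → ℕ) → Vec ℕ N → ℕ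
convolution g h ℓ = sum (map (λ m → g m ℕ.* h (zipWith _∸_ ℓ m)) (boxBelow ℓ))

convolution-∷ : ∀ {N} (g h : Vec ℕ (suc N) → ℕ) a ℓ →
                convolution g h (a ∷ ℓ) ≡
                sum (applyUpTo (λ i → convolution (g ∘ (i ∷_)) (h ∘ ((a ∸ i) ∷_)) ℓ) (suc a))
convolution-∷ g h a ℓ = begin
  convolution g h (a ∷ ℓ)
    ≡⟨ sum-map-concatMap (λ i → map (i ∷_) (boxBelow ℓ)) term (upTo (suc a)) ⟩
  sum (map (λ i → sum (map term (map (i ∷_) (boxBelow ℓ)))) (upTo (suc a)))
    ≡⟨ ≡.cong sum (map-cong (λ i → ≡.cong sum (≡.sym (map-∘ (boxBelow ℓ)))) (upTo (suc a))) ⟩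
  sum (map (λ i → convolution (g ∘ (i ∷_)) (h ∘ ((a ∸ i) ∷_)) ℓ) (upTo (suc a)))
    ≡⟨ ≡.cong sum (map-applyUpTo id _ (suc a)) ⟩
  sum (applyUpTo (λ i → convolution (g ∘ (i ∷_)) (h ∘ ((a ∸ i) ∷_)) ℓ) (suc a))
    ∎
  where
  open ≡.≡-Reasoning
  term = λ m → g m ℕ.* h (zipWith _∸_ (a ∷ ℓ) m)

binomF-zero : ∀ {N} (f : Vec ℕ N → ℕ) ℓ → binomF f 0 ℓ ≡ (if isZeroVec ℓ then 1 else 0)
binomF-zero f ℓ with isZeroVec ℓ
... | true  = ≡.refl
... | false = ≡.refl

binomF-suc : ∀ {N} (f : Vec ℕ N → ℕ) k ℓ → binomF f (suc k) ℓ ≡ convolution f (binomF f k) ℓ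
binomF-suc f k ℓ = ≡.trans (sum-map-concatMap (λ m → map (m ∷_) (rest m)) (prodF f) (boxBelow ℓ))
                           (≡.cong sum (map-cong first-factor (boxBelow ℓ)))
  where
  rest = λ m → tuples k (zipWith _∸_ ℓ m)
  first-factor : ∀ m → sum (map (prodF f) (map (m ∷_) (rest m))) ≡ f m ℕ.* binomF f k (zipWith _∸_ ℓ m)
  first-factor m = ≡.trans (≡.cong sum (≡.sym (map-∘ (rest m)))) (sum-map-*ˡ (f m) (prodF f) (rest m))

scale-* : ∀ {N} m n (v : Vec ℕ N) → scale (m ℕ.* n) v ≡ scale m (scale n v)
scale-* m n []      = ≡.refl
scale-* m n (a ∷ v) = ≡.cong₂ _∷_ (ℕ.*-assoc m n a) (scale-* m n v)

scale-1 : ∀ {N} (v : Vec ℕ N) → scale 1 v ≡ v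
scale-1 []      = ≡.refl
scale-1 (a ∷ v) = ≡.cong₂ _∷_ (ℕ.*-identityˡ a) (scale-1 v)

module MultivariateSeries {p : ℕ} (p-prime : Prime p) where

  private instance
    p-nonZero : NonZero p
    p-nonZero = prime⇒nonZero p-prime

  open ℕModulo p using (_≡ₚ_; ≡⇒≡ₚ; sum-map-cong)

  convolution-cong : ∀ {N} {g g′ h h′ : Vec ℕ N → ℕ} →
                     (∀ m → g m ≡ₚ g′ m) → (∀ m → h m ≡ₚ h′ m) →
                     ∀ ℓ → convolution g h ℓ ≡ₚ convolution g′ h′ ℓ
  convolution-cong {g = g} {g′} {h} {h′} g≡g′ h≡h′ ℓ =
    sum-map-cong (boxBelow ℓ) λ m → ℕModulo.*-cong p {g m} {g′ m} (g≡g′ m) (h≡h′ (zipWith _∸_ ℓ m))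

  -- Formal power series in N variables over ℕ modulo p, as N-fold iterated one-variable series.
  Tower : ℕ → CommutativeSemiring 0ℓ 0ℓ
  Tower zero    = ℕModulo.commutativeSemiring p
  Tower (suc N) = PowerSeries.commutativeSemiring (Tower N)

  module 𝕊 N = CommutativeSemiring (Tower N)
  module Mult𝕊 N = Algebra.Properties.Semiring.Mult (𝕊.semiring N)
  module Exp𝕊 N = Algebra.Properties.Semiring.Exp (𝕊.semiring N)

  -- dilate N F = F(X₁^p, …, X_N^p)
  dilate : ∀ N → 𝕊.Carrier N → 𝕊.Carrier N
  dilate zero    = id
  dilate (suc N) = PowerSeries.spread (Tower N) p (dilate N)

  characteristic : ∀ N a → 𝕊._≈_ N (Mult𝕊._×_ N p a) (𝕊.0# N)
  characteristic zero    = ℕModulo.characteristic p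
  characteristic (suc N) = PowerSeries.characteristic (Tower N) p (characteristic N)

  ^p≈dilate : ∀ N a → 𝕊._≈_ N (Exp𝕊._^_ N a p) (dilate N a)
  ^p≈dilate zero    = ℕModulo.fermat p p-prime
  ^p≈dilate (suc N) =
    PowerSeries.Frobenius.^p≈spread (Tower N) p-prime (characteristic N) (dilate N) (^p≈dilate N)

  ^p^m≈iterate : ∀ N m a → 𝕊._≈_ N (Exp𝕊._^_ N a (p ℕ.^ m)) (iterate (dilate N) a m)
  ^p^m≈iterate N zero    a = 𝕊.*-identityʳ N a
  ^p^m≈iterate N (suc m) a = begin
    a ^ₛ (p ℕ.* p ℕ.^ m)               ≈⟨ ^-assocʳ a p (p ℕ.^ m) ⟨
    (a ^ₛ p) ^ₛ (p ℕ.^ m)              ≈⟨ ^-congˡ (p ℕ.^ m) (^p≈dilate N a) ⟩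
    dilate N a ^ₛ (p ℕ.^ m)            ≈⟨ ^p^m≈iterate N m (dilate N a) ⟩
    iterate (dilate N) (dilate N a) m  ∎
    where
    open Exp𝕊 N using (^-assocʳ; ^-congˡ) renaming (_^_ to _^ₛ_)
    open import Relation.Binary.Reasoning.Setoid (𝕊.setoid N)

  coeff : ∀ N → 𝕊.Carrier N → Vec ℕ N → ℕ
  coeff zero    a []      = a
  coeff (suc N) F (i ∷ ℓ) = coeff N (F i) ℓ

  generating : ∀ N → (Vec ℕ N → ℕ) → 𝕊.Carrier N
  generating zero    f   = f []
  generating (suc N) f i = generating N (f ∘ (i ∷_))

  coeff-generating : ∀ N f ℓ → coeff N (generating N f) ℓ ≡ f ℓ
  coeff-generating zero    f []      = ≡.refl
  coeff-generating (suc N) f (i ∷ ℓ) = coeff-generating N (f ∘ (i ∷_)) ℓ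

  coeff-cong : ∀ N {F G} → 𝕊._≈_ N F G → ∀ ℓ → coeff N F ℓ ≡ₚ coeff N G ℓ
  coeff-cong zero    F≈G []      = F≈G
  coeff-cong (suc N) F≈G (i ∷ ℓ) = coeff-cong N (F≈G i) ℓ

  coeff-0# : ∀ N ℓ → coeff N (𝕊.0# N) ℓ ≡ 0
  coeff-0# zero    []      = ≡.refl
  coeff-0# (suc N) (i ∷ ℓ) = coeff-0# N ℓ

  coeff-1# : ∀ N ℓ → coeff N (𝕊.1# N) ℓ ≡ (if isZeroVec ℓ then 1 else 0)
  coeff-1# zero    []          = ≡.refl
  coeff-1# (suc N) (zero ∷ ℓ)  = coeff-1# N ℓ
  coeff-1# (suc N) (suc i ∷ ℓ) = coeff-0# N ℓ

  coeff-+ : ∀ N F G ℓ → coeff N (𝕊._+_ N F G) ℓ ≡ coeff N F ℓ ℕ.+ coeff N G ℓ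
  coeff-+ zero    F G []      = ≡.refl
  coeff-+ (suc N) F G (i ∷ ℓ) = coeff-+ N (F i) (G i) ℓ

  coeff-sum : ∀ N xs ℓ → coeff N (foldr (𝕊._+_ N) (𝕊.0# N) xs) ℓ ≡ sum (map (λ F → coeff N F ℓ) xs)
  coeff-sum N []       ℓ = coeff-0# N ℓ
  coeff-sum N (F ∷ xs) ℓ = ≡.trans (coeff-+ N F _ ℓ) (≡.cong (coeff N F ℓ ℕ.+_) (coeff-sum N xs ℓ))

  coeff-* : ∀ N F G ℓ → coeff N (𝕊._*_ N F G) ℓ ≡ₚ convolution (coeff N F) (coeff N G) ℓ
  coeff-* zero    F G []      = ≡⇒≡ₚ (≡.sym (ℕ.+-identityʳ (F ℕ.* G)))
  coeff-* (suc N) F G (a ∷ ℓ) = begin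
    coeff N ((F *ₛ G) a) ℓ
      ≈⟨ coeff-cong N (*ₛ-coeff F G a) ℓ ⟩
    coeff N (foldr (𝕊._+_ N) (𝕊.0# N) (applyUpTo terms (suc a))) ℓ
      ≡⟨ ≡.trans (coeff-sum N (applyUpTo terms (suc a)) ℓ) (≡.cong sum (map-applyUpTo terms _ (suc a))) ⟩
    sum (applyUpTo (λ i → coeff N (terms i) ℓ) (suc a))
      ≈⟨ sum-applyUpTo-cong (suc a) (λ i → coeff-* N (F i) (G (a ∸ i)) ℓ) ⟩
    sum (applyUpTo (λ i → convolution (coeff N (F i)) (coeff N (G (a ∸ i))) ℓ) (suc a))
      ≡⟨ convolution-∷ (coeff (suc N) F) (coeff (suc N) G) a ℓ ⟨
    convolution (coeff (suc N) F) (coeff (suc N) G) (a ∷ ℓ)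
      ∎
    where
    open PowerSeries (Tower N) using (_*ₛ_; *ₛ-coeff)
    open import Relation.Binary.Reasoning.Setoid (𝕊.setoid zero)
    terms = λ i → 𝕊._*_ N (F i) (G (a ∸ i))
    sum-applyUpTo-cong : ∀ {g h} n → (∀ i → g i ≡ₚ h i) → sum (applyUpTo g n) ≡ₚ sum (applyUpTo h n)
    sum-applyUpTo-cong {g} {h} n g≡h = begin
      sum (applyUpTo g n)   ≡⟨ ≡.cong sum (map-applyUpTo id g n) ⟨
      sum (map g (upTo n))  ≈⟨ sum-map-cong (upTo n) g≡h ⟩
      sum (map h (upTo n))  ≡⟨ ≡.cong sum (map-applyUpTo id h n) ⟩
      sum (applyUpTo h n)   ∎

  binomF≡ₚcoeff : ∀ N f k ℓ → binomF f k ℓ ≡ₚ coeff N (Exp𝕊._^_ N (generating N f) k) ℓ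
  binomF≡ₚcoeff N f zero    ℓ = ≡⇒≡ₚ (≡.trans (binomF-zero f ℓ) (≡.sym (coeff-1# N ℓ)))
  binomF≡ₚcoeff N f (suc k) ℓ = begin
    binomF f (suc k) ℓ                            ≡⟨ binomF-suc f k ℓ ⟩
    convolution f (binomF f k) ℓ                  ≈⟨ convolution-cong f≡coeff (binomF≡ₚcoeff N f k) ℓ ⟩
    convolution (coeff N F) (coeff N (F ^ₛ k)) ℓ  ≈⟨ coeff-* N F (F ^ₛ k) ℓ ⟨
    coeff N (F ^ₛ suc k) ℓ                        ∎
    where
    open Exp𝕊 N using () renaming (_^_ to _^ₛ_)
    open import Relation.Binary.Reasoning.Setoid (𝕊.setoid zero)
    F = generating N f
    f≡coeff : ∀ m → f m ≡ₚ coeff N F m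
    f≡coeff m = ≡⇒≡ₚ (≡.sym (coeff-generating N f m))

  coeff-dilate-scale : ∀ N F v → coeff N (dilate N F) (scale p v) ≡ coeff N F v
  coeff-dilate-scale zero    F []      = ≡.refl
  coeff-dilate-scale (suc N) F (a ∷ v) =
    ≡.trans (≡.cong₂ (λ r q → coeff N (onMultiple r (dilate N (F q))) (scale p v)) [p*a]%p≡0 [p*a]/p≡a)
            (coeff-dilate-scale N (F a) v)
    where
    open PowerSeries (Tower N) using (onMultiple)
    [p*a]%p≡0 : p ℕ.* a % p ≡ 0
    [p*a]%p≡0 = ≡.trans (≡.cong (_% p) (ℕ.*-comm p a)) (m*n%n≡0 a p)
    [p*a]/p≡a : p ℕ.* a / p ≡ a
    [p*a]/p≡a = ≡.trans (≡.cong (_/ p) (ℕ.*-comm p a)) (m*n/n≡m a p)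

  coeff-dilate-support : ∀ N F ℓ → coeff N (dilate N F) ℓ ≡ 0 ⊎ ∃ λ w → ℓ ≡ scale p w
  coeff-dilate-support zero    F []      = inj₂ ([] , ≡.refl)
  coeff-dilate-support (suc N) F (a ∷ ℓ) with a % p in a%p≡0
  ... | suc _ = inj₁ (coeff-0# N ℓ)
  ... | zero  with coeff-dilate-support N (F (a / p)) ℓ
  ...   | inj₁ c≡0       = inj₁ c≡0
  ...   | inj₂ (w , ℓ≡pw) = inj₂ (a / p ∷ w , ≡.cong₂ _∷_ a≡p*[a/p] ℓ≡pw)
    where
    a≡p*[a/p] : a ≡ p ℕ.* (a / p)
    a≡p*[a/p] = ≡.trans (m≡m%n+[m/n]*n a p)
                        (≡.trans (≡.cong (ℕ._+ a / p ℕ.* p) a%p≡0) (ℕ.*-comm (a / p) p))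

  scale-p^[1+m] : ∀ {N} m (v : Vec ℕ N) → scale (p ℕ.^ suc m) v ≡ scale (p ℕ.^ m) (scale p v)
  scale-p^[1+m] m v = ≡.trans (≡.cong (λ c → scale c v) (ℕ.*-comm p (p ℕ.^ m))) (scale-* (p ℕ.^ m) p v)

  coeff-iterate-scale : ∀ N m F v → coeff N (iterate (dilate N) F m) (scale (p ℕ.^ m) v) ≡ coeff N F v
  coeff-iterate-scale N zero    F v = ≡.cong (coeff N F) (scale-1 v)
  coeff-iterate-scale N (suc m) F v = begin
    coeff N (iterate (dilate N) (dilate N F) m) (scale (p ℕ.^ suc m) v)
      ≡⟨ ≡.cong (coeff N _) (scale-p^[1+m] m v) ⟩
    coeff N (iterate (dilate N) (dilate N F) m) (scale (p ℕ.^ m) (scale p v))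
      ≡⟨ coeff-iterate-scale N m (dilate N F) (scale p v) ⟩
    coeff N (dilate N F) (scale p v)
      ≡⟨ coeff-dilate-scale N F v ⟩
    coeff N F v
      ∎
    where open ≡.≡-Reasoning

  coeff-iterate-support : ∀ N m F ℓ →
                          coeff N (iterate (dilate N) F m) ℓ ≡ 0 ⊎ ∃ λ v → ℓ ≡ scale (p ℕ.^ m) v
  coeff-iterate-support N zero    F ℓ = inj₂ (ℓ , ≡.sym (scale-1 ℓ))
  coeff-iterate-support N (suc m) F ℓ with coeff-iterate-support N m (dilate N F) ℓ
  ... | inj₁ c≡0          = inj₁ c≡0
  ... | inj₂ (w , ≡.refl) with coeff-dilate-support N F w
  ...   | inj₁ c≡0          = inj₁ (≡.trans (coeff-iterate-scale N m (dilate N F) w) c≡0)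
  ...   | inj₂ (v , ≡.refl) = inj₂ (v , ≡.sym (scale-p^[1+m] m v))

-- Imported only now: above, _^_ and _×_ are the power and multiple of a semiring.
open import Data.Nat using (_^_)
open import Data.Product using (_×_)

theorem9 : (N : ℕ) → 1 ≤ N → (f : Vec ℕ N → ℕ) → (p : ℕ) → .{{_ : NonZero p}} → Prime p →
           (m : ℕ) → 1 ≤ m → (ℓ : Vec ℕ N) →
           ((v : Vec ℕ N) → ℓ ≡ scale (p ^ m) v → binomF f (p ^ m) ℓ % p ≡ f v % p)
           × ((¬ ∃ λ (v : Vec ℕ N) → ℓ ≡ scale (p ^ m) v) → binomF f (p ^ m) ℓ % p ≡ 0)
theorem9 N _ f p p-prime m _ ℓ = on-lattice , off-lattice
  where
  open MultivariateSeries p-prime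
  F = generating N f

  binomF≡ₚcoeff-iterate : binomF f (p ^ m) ℓ % p ≡ coeff N (iterate (dilate N) F m) ℓ % p
  binomF≡ₚcoeff-iterate = ≡.trans (binomF≡ₚcoeff N f (p ^ m) ℓ) (coeff-cong N (^p^m≈iterate N m F) ℓ)

  on-lattice : (v : Vec ℕ N) → ℓ ≡ scale (p ^ m) v → binomF f (p ^ m) ℓ % p ≡ f v % p
  on-lattice v ≡.refl = ≡.trans binomF≡ₚcoeff-iterate
    (≡.cong (_% p) (≡.trans (coeff-iterate-scale N m F v) (coeff-generating N f v)))

  off-lattice : (¬ ∃ λ v → ℓ ≡ scale (p ^ m) v) → binomF f (p ^ m) ℓ % p ≡ 0
  off-lattice ∄v with coeff-iterate-support N m F ℓ
  ... | inj₁ c≡0 = ≡.trans binomF≡ₚcoeff-iterate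
                     (≡.trans (≡.cong (_% p) c≡0) (m<n⇒m%n≡m (ℕ.>-nonZero⁻¹ p)))
  ... | inj₂ v   = contradiction v ∄v
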